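{- Let $n\ge 1$ and let $(a_1=1,a_2,\ldots,a_n)$ be an $n$-cycle in the symmetric group $S_n$, written as the word $a_1a_2\cdots a_n$ beginning with $1$. Then a consecutive $i$-standard structure on this cycle exists and is unique; that is, the minimal number $i$ of blocks in a partition of $\{1,\ldots,n\}$ into blocks of the form $\{c,c+1,\ldots,c+r\}$ such that within each block the integers $c,c+1,\ldots,c+r$ occur from left to right in increasing order in the word $a_1a_2\cdots a_n$ is attained by exactly one such partition.
   Context: A consecutive $i$-standard structure (or $i$-standard consecutive structure) on the $n$-cycle $(a_1=1,a_2,\ldots,a_n)$ is a partition of $\{1,\ldots,n\}$ into $i$ blocks, each block consisting of consecutive integers $a_{s1}<a_{s2}<\ldots<a_{sj_s}$ with $a_{st}=a_{s1}+(t-1)$, such that $a_{s(t+1)}$ occurs to the right of $a_{st}$ in the word $a_1a_2\cdots a_n$, and such that $i$ is minimal among all such partitions. -}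

module Defs where

open import Data.Nat using (ℕ; suc)
open import Data.Fin using (Fin; zero; _≤_; _<_)
open import Data.Fin.Permutation using (Permutation′; _⟨$⟩ʳ_)
open import Data.Product using (_×_; ∃)
open import Relation.Binary.PropositionalEquality using (_≡_)

-- A word a₁…aₙ (a permutation of {1,…,n}, here of Fin n = {0,…,n-1})
-- is a permutation π : positions → values, a_p = π ⟨$⟩ʳ p.
-- A partition of {1,…,n} into i blocks is a surjective labelling
-- f : Fin n → Fin i of the values (block of x = f x); partitions are
-- identified up to relabelling of blocks.

Surj : ∀ {n i} → (Fin n → Fin i) → Set
Surj {n} {i} f = ∀ (b : Fin i) → ∃ λ (x : Fin n) → f x ≡ b

ConsecutiveBlocks : ∀ {n i} → (Fin n → Fin i) → Set
ConsecutiveBlocks {n} f = ∀ (x y z : Fin n) → x ≤ z → z ≤ y → f x ≡ f y → f z ≡ f x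

IncreasingInWord : ∀ {n i} → Permutation′ n → (Fin n → Fin i) → Set
IncreasingInWord {n} π f =
  ∀ (p q : Fin n) → f (π ⟨$⟩ʳ p) ≡ f (π ⟨$⟩ʳ q) → π ⟨$⟩ʳ p < π ⟨$⟩ʳ q → p < q

IsConsecStructure : ∀ {n} → Permutation′ n → (i : ℕ) → (Fin n → Fin i) → Set
IsConsecStructure π i f = Surj f × ConsecutiveBlocks f × IncreasingInWord π f

IsStandardConsec : ∀ {n} → Permutation′ n → (i : ℕ) → (Fin n → Fin i) → Set
IsStandardConsec {n} π i f =
  IsConsecStructure π i f ×
  (∀ (j : ℕ) (g : Fin n → Fin j) → IsConsecStructure π j g → i Data.Nat.≤ j)

SamePartition : ∀ {n i j} → (Fin n → Fin i) → (Fin n → Fin j) → Set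
SamePartition {n} f g = ∀ (x y : Fin n) → (f x ≡ f y → g x ≡ g y) × (g x ≡ g y → f x ≡ f y)

StartsWithOne : ∀ {m} → Permutation′ (suc m) → Set
StartsWithOne π = π ⟨$⟩ʳ zero ≡ zero

module Submission where

open import Defs
open import Data.Nat using (ℕ; suc)
open import Data.Fin using (Fin)
open import Data.Fin.Permutation using (Permutation′)
open import Data.Product using (_×_; ∃; Σ)

open import Data.Nat using (zero; z≤n; s≤s; _≤_; _<_; _≤′_; ≤′-step; ≤′-reflexive)
open import Data.Nat.Properties
  using (≤-refl; ≤-trans; ≤-antisym; ≤-total; _≤?_; <⇒≤; ≤-pred; n<1+n; n≤1+n;
         ≤⇒≤′; ≤′⇒≤; m≤n⇒m≤1+n; m<n⇒m<1+n; <-≤-trans; <-irrefl; ≰⇒>; m<1+n⇒m<n∨m≡n; n≤0⇒n≡0)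
open import Data.Fin as F using (toℕ; fromℕ<)
open import Data.Fin.Properties using (toℕ-injective; toℕ-fromℕ<; toℕ≤pred[n]; injective⇒≤)
import Data.Fin.Properties as Fin
open import Data.Fin.Permutation using (_⟨$⟩ʳ_; _⟨$⟩ˡ_; inverseʳ; inverseˡ)
open import Data.Product using (_,_; proj₁; proj₂)
open import Data.Sum using (inj₁; inj₂)
open import Data.Empty using (⊥-elim)
open import Relation.Nullary using (¬_; yes; no; ¬?)
open import Relation.Unary using (Decidable)
open import Relation.Binary.PropositionalEquality
open import Relation.Binary.Definitions using (tri<; tri≈; tri>)
open import Function.Definitions using (Injective)

-- The values of the word are 0,…,m (standing for 1,…,m+1).  Call z < m a
-- *descent* of π when z+1 stands to the left of z in the word, and a *cut*
-- of a labelling g when g z ≢ g (z+1).  Let D be the number of descents.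
--  (1) The labels of a consecutive labelling change only at its cuts, and
--      values separated by a cut never share a label again; hence a
--      consecutive labelling uses at least 1 + #cuts labels.
--  (2) If the blocks increase in the word, every descent is a cut, so every
--      consecutive structure has at least 1 + D blocks.
--  (3) Labelling x by the number of descents below x is a consecutive
--      structure with exactly 1 + D blocks; it is therefore standard.
--  (4) A standard structure has 1 + D blocks, so by (1) at most D cuts; as
--      all D descents are cuts, its cuts are exactly the descents.  Two
--      consecutive labellings with the same cuts define the same partition.

module _ {A : Set} (_∼_ : A → A → Set)
         (∼-refl : ∀ {a} → a ∼ a) (∼-trans : ∀ {a b c} → a ∼ b → b ∼ c → a ∼ c) where

  stepwise : (h : ℕ → A) {v w : ℕ} → v ≤ w →
    (∀ z → v ≤ z → z < w → h z ∼ h (suc z)) → h v ∼ h w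
  stepwise h {v} v≤w = go (≤⇒≤′ v≤w)
    where
      go : ∀ {w} → v ≤′ w → (∀ z → v ≤ z → z < w → h z ∼ h (suc z)) → h v ∼ h w
      go (≤′-reflexive refl) steps = ∼-refl
      go {suc w} (≤′-step v≤′w) steps =
        ∼-trans (go v≤′w (λ z v≤z z<w → steps z v≤z (m<n⇒m<1+n z<w)))
                (steps w (≤′⇒≤ v≤′w) (n<1+n w))

stepwise-≡ : ∀ {A : Set} (h : ℕ → A) {v w : ℕ} → v ≤ w →
  (∀ z → v ≤ z → z < w → h z ≡ h (suc z)) → h v ≡ h w
stepwise-≡ = stepwise _≡_ refl trans

stepwise-≤ : (h : ℕ → ℕ) {v w : ℕ} → v ≤ w →
  (∀ z → v ≤ z → z < w → h z ≤ h (suc z)) → h v ≤ h w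
stepwise-≤ = stepwise _≤_ ≤-refl ≤-trans

stepwise-< : (h : ℕ → ℕ) {v w : ℕ} → v < w →
  (∀ z → v ≤ z → z < w → h z < h (suc z)) → h v < h w
stepwise-< h {v} v<w steps = <-≤-trans (steps v ≤-refl v<w)
  (stepwise-≤ h v<w (λ z 1+v≤z z<w → <⇒≤ (steps z (≤-trans (n≤1+n v) 1+v≤z) z<w)))

count : {P : ℕ → Set} → Decidable P → ℕ → ℕ
count d zero = zero
count d (suc v) with d v
... | yes _ = suc (count d v)
... | no _ = count d v

module _ {P : ℕ → Set} (d : Decidable P) where

  count-absent : ∀ {v} → ¬ P v → count d (suc v) ≡ count d v
  count-absent {v} ¬p with d v
  ... | yes p = ⊥-elim (¬p p)
  ... | no _ = refl

  count-present : ∀ {v} → P v → count d (suc v) ≡ suc (count d v)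
  count-present {v} p with d v
  ... | yes _ = refl
  ... | no ¬p = ⊥-elim (¬p p)

  count-step≤1 : ∀ v → count d (suc v) ≤ suc (count d v)
  count-step≤1 v with d v
  ... | yes _ = ≤-refl
  ... | no _ = n≤1+n _

  count-mono : ∀ {v w} → v ≤ w → count d v ≤ count d w
  count-mono v≤w = stepwise-≤ (count d) v≤w (λ z _ _ → step z)
    where
      step : ∀ z → count d z ≤ count d (suc z)
      step z with d z
      ... | yes _ = n≤1+n _
      ... | no _ = ≤-refl

  count-flat : ∀ {v z w} → v ≤ z → z < w → count d v ≡ count d w → ¬ P z
  count-flat {v} {z} {w} v≤z z<w same p = <-irrefl refl
    (begin-strict
      count d z        <⟨ subst (count d z <_) (sym (count-present p)) (n<1+n _) ⟩
      count d (suc z)  ≤⟨ count-mono z<w ⟩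
      count d w        ≡⟨ sym same ⟩
      count d v        ≤⟨ count-mono v≤z ⟩
      count d z        ∎)
    where open Data.Nat.Properties.≤-Reasoning

  count-attains : ∀ N k → k ≤ count d N → Σ ℕ λ v → v ≤ N × count d v ≡ k
  count-attains zero k k≤0 = zero , z≤n , sym (n≤0⇒n≡0 k≤0)
  count-attains (suc N) k k≤ with k ≤? count d N
  ... | yes k≤′ = let (v , v≤N , hit) = count-attains N k k≤′ in v , m≤n⇒m≤1+n v≤N , hit
  ... | no k≰ = suc N , ≤-refl , ≤-antisym (≤-trans (count-step≤1 N) (≰⇒> k≰)) k≤

module _ {P Q : ℕ → Set} (dP : Decidable P) (dQ : Decidable Q) where

  private
    restrict : ∀ {N} → (∀ z → z < suc N → P z → Q z) → ∀ z → z < N → P z → Q z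
    restrict P⊆Q z z<N = P⊆Q z (m<n⇒m<1+n z<N)

  count-⊆ : ∀ N → (∀ z → z < N → P z → Q z) → count dP N ≤ count dQ N
  count-⊆ zero P⊆Q = z≤n
  count-⊆ (suc N) P⊆Q with dP N | dQ N
  ... | yes _ | yes _ = s≤s (count-⊆ N (restrict P⊆Q))
  ... | yes p | no ¬q = ⊥-elim (¬q (P⊆Q N (n<1+n N) p))
  ... | no _ | yes _ = m≤n⇒m≤1+n (count-⊆ N (restrict P⊆Q))
  ... | no _ | no _ = count-⊆ N (restrict P⊆Q)

  count-⊆-tight : ∀ N → (∀ z → z < N → P z → Q z) → count dQ N ≤ count dP N →
    ∀ z → z < N → Q z → P z
  count-⊆-tight (suc N) P⊆Q Q≤P z z<1+N q with dP N | dQ N | m<1+n⇒m<n∨m≡n z<1+N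
  ... | yes p | _ | inj₂ refl = p
  ... | yes _ | yes _ | inj₁ z<N = count-⊆-tight N (restrict P⊆Q) (≤-pred Q≤P) z z<N q
  ... | yes p | no ¬q | inj₁ _ = ⊥-elim (¬q (P⊆Q N (n<1+n N) p))
  ... | no _ | yes _ | _ = ⊥-elim (<-irrefl refl (≤-trans Q≤P (count-⊆ N (restrict P⊆Q))))
  ... | no _ | no ¬q | inj₂ refl = ⊥-elim (¬q q)
  ... | no _ | no _ | inj₁ z<N = count-⊆-tight N (restrict P⊆Q) Q≤P z z<N q

-- The value v ≤ m as an element of Fin (suc m); larger arguments are
-- sent to 0 but never used.  This lets us walk through 0,…,m in ℕ.
fin : (m : ℕ) → ℕ → Fin (suc m)
fin zero _ = F.zero
fin (suc m) zero = F.zero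
fin (suc m) (suc v) = F.suc (fin m v)

toℕ-fin : ∀ m {v} → v ≤ m → toℕ (fin m v) ≡ v
toℕ-fin zero {zero} _ = refl
toℕ-fin (suc m) {zero} _ = refl
toℕ-fin (suc m) {suc v} (s≤s v≤m) = cong suc (toℕ-fin m v≤m)

fin-toℕ : ∀ m (x : Fin (suc m)) → fin m (toℕ x) ≡ x
fin-toℕ m x = toℕ-injective (toℕ-fin m (toℕ≤pred[n] x))

fin-mono : ∀ m {v z} → v ≤ z → z ≤ m → fin m v F.≤ fin m z
fin-mono m {v} {z} v≤z z≤m =
  subst₂ _≤_ (sym (toℕ-fin m (≤-trans v≤z z≤m))) (sym (toℕ-fin m z≤m)) v≤z

module Labelling {m j : ℕ} (g : Fin (suc m) → Fin j) where

  label : ℕ → Fin j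
  label z = g (fin m z)

  Cut : ℕ → Set
  Cut z = label z ≢ label (suc z)

  cut? : Decidable Cut
  cut? z = ¬? (label z Fin.≟ label (suc z))

  cuts : ℕ → ℕ
  cuts = count cut?

  cuts-along : ∀ {u w} → u ≤ w → (∀ z → u ≤ z → z < w → label z ≡ label (suc z)) →
    cuts u ≡ cuts w
  cuts-along u≤w no-cut = stepwise-≡ cuts u≤w
    (λ z u≤z z<w → sym (count-absent cut? (λ cut → cut (no-cut z u≤z z<w))))

  module Consecutive (consecutive : ConsecutiveBlocks g) where

    no-cut-between : ∀ {v w} → v ≤ w → w ≤ m → label v ≡ label w →
      ∀ z → v ≤ z → z < w → label z ≡ label (suc z)
    no-cut-between {v} {w} v≤w w≤m same z v≤z z<w =
      trans (inside v≤z (<⇒≤ z<w)) (sym (inside (m≤n⇒m≤1+n v≤z) z<w))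
      where
        inside : ∀ {u} → v ≤ u → u ≤ w → label u ≡ label v
        inside {u} v≤u u≤w = consecutive (fin m v) (fin m w) (fin m u)
          (fin-mono m v≤u (≤-trans u≤w w≤m)) (fin-mono m u≤w w≤m) same

    same-label⇒same-cuts : ∀ {v v′} → v ≤ m → v′ ≤ m → label v ≡ label v′ → cuts v ≡ cuts v′
    same-label⇒same-cuts {v} {v′} v≤m v′≤m same with ≤-total v v′
    ... | inj₁ v≤v′ = cuts-along v≤v′ (no-cut-between v≤v′ v′≤m same)
    ... | inj₂ v′≤v = sym (cuts-along v′≤v (no-cut-between v′≤v v≤m (sym same)))

    -- (1) Choosing, for each k ≤ cuts m, a value with exactly k cuts below
    -- it gives pairwise differently labelled values: at least 1 + cuts m labels.
    cuts<labels : suc (cuts m) ≤ j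
    cuts<labels = injective⇒≤ {f = representative-label} representative-injective
      where
        representative : (k : Fin (suc (cuts m))) → Σ ℕ λ v → v ≤ m × cuts v ≡ toℕ k
        representative k = count-attains cut? m (toℕ k) (toℕ≤pred[n] k)

        representative-label : Fin (suc (cuts m)) → Fin j
        representative-label k = label (proj₁ (representative k))

        representative-injective : Injective _≡_ _≡_ representative-label
        representative-injective {k} {k′} same = toℕ-injective (begin
          toℕ k         ≡⟨ sym (proj₂ (proj₂ (representative k))) ⟩
          cuts v        ≡⟨ same-label⇒same-cuts (proj₁ (proj₂ (representative k)))
                                                (proj₁ (proj₂ (representative k′))) same ⟩
          cuts v′       ≡⟨ proj₂ (proj₂ (representative k′)) ⟩
          toℕ k′        ∎)
          where
            open ≡-Reasoning
            v = proj₁ (representative k)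
            v′ = proj₁ (representative k′)

module _ {m i j} (f : Fin (suc m) → Fin i) (g : Fin (suc m) → Fin j)
         (consecutive : ConsecutiveBlocks f)
         (kept : ∀ z → z < m → Labelling.label f z ≡ Labelling.label f (suc z) →
                               Labelling.label g z ≡ Labelling.label g (suc z)) where
  open Labelling using (label)

  private
    left-to-right : ∀ x y → toℕ x ≤ toℕ y → f x ≡ f y → g x ≡ g y
    left-to-right x y x≤y same = subst₂ (λ a b → g a ≡ g b) (fin-toℕ m x) (fin-toℕ m y)
        (stepwise-≡ (label g) x≤y (λ z x≤z z<y →
          kept z (<-≤-trans z<y y≤m)
            (Labelling.Consecutive.no-cut-between f consecutive x≤y y≤m same′ z x≤z z<y)))
      where
        y≤m = toℕ≤pred[n] y
        same′ : label f (toℕ x) ≡ label f (toℕ y)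
        same′ = subst₂ (λ a b → f a ≡ f b) (sym (fin-toℕ m x)) (sym (fin-toℕ m y)) same

  blocks-refine : ∀ x y → f x ≡ f y → g x ≡ g y
  blocks-refine x y same with ≤-total (toℕ x) (toℕ y)
  ... | inj₁ x≤y = left-to-right x y x≤y same
  ... | inj₂ y≤x = sym (left-to-right y x y≤x (sym same))

module Word (m : ℕ) (π : Permutation′ (suc m)) where

  position : ℕ → Fin (suc m)
  position v = π ⟨$⟩ˡ fin m v

  value-at-position : ∀ v → π ⟨$⟩ʳ position v ≡ fin m v
  value-at-position v = inverseʳ π

  Descent : ℕ → Set
  Descent z = position (suc z) F.< position z

  descent? : Decidable Descent
  descent? z = position (suc z) Fin.<? position z

  descents : ℕ → ℕ
  descents = count descent?

  -- Distinct values have distinct positions, so at a non-descent z < m the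
  -- value z+1 stands to the right of z.
  ascent : ∀ {z} → z < m → ¬ Descent z → toℕ (position z) < toℕ (position (suc z))
  ascent {z} z<m ¬descent with Fin.<-cmp (position z) (position (suc z))
  ... | tri< before _ _ = before
  ... | tri> _ _ after = ⊥-elim (¬descent after)
  ... | tri≈ _ same _ = ⊥-elim (<-irrefl z≡1+z (n<1+n z))
    where
      open ≡-Reasoning
      z≡1+z : z ≡ suc z
      z≡1+z = begin
        z                               ≡⟨ sym (toℕ-fin m (<⇒≤ z<m)) ⟩
        toℕ (fin m z)                   ≡⟨ cong toℕ (sym (value-at-position z)) ⟩
        toℕ (π ⟨$⟩ʳ position z)         ≡⟨ cong (λ p → toℕ (π ⟨$⟩ʳ p)) same ⟩
        toℕ (π ⟨$⟩ʳ position (suc z))   ≡⟨ cong toℕ (value-at-position (suc z)) ⟩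
        toℕ (fin m (suc z))             ≡⟨ toℕ-fin m z<m ⟩
        suc z                           ∎

  module _ {j : ℕ} (g : Fin (suc m) → Fin j) where
    open Labelling g

    descent⇒cut : IncreasingInWord π g → ∀ z → z < m → Descent z → Cut z
    descent⇒cut increasing z z<m descent same =
      Fin.<-asym descent (increasing (position z) (position (suc z)) same′ in-order)
      where
        same′ : g (π ⟨$⟩ʳ position z) ≡ g (π ⟨$⟩ʳ position (suc z))
        same′ = subst₂ (λ a b → g a ≡ g b)
                  (sym (value-at-position z)) (sym (value-at-position (suc z))) same
        in-order : π ⟨$⟩ʳ position z F.< π ⟨$⟩ʳ position (suc z)
        in-order = subst₂ F._<_ (sym (value-at-position z)) (sym (value-at-position (suc z)))
                     (subst₂ _<_ (sym (toℕ-fin m (<⇒≤ z<m))) (sym (toℕ-fin m z<m)) (n<1+n z))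

    structure-bound : IsConsecStructure π j g → suc (descents m) ≤ j
    structure-bound (_ , consecutive , increasing) =
      ≤-trans (s≤s (count-⊆ descent? cut? m (descent⇒cut increasing))) cuts<labels
      where open Consecutive consecutive

  canonical : Fin (suc m) → Fin (suc (descents m))
  canonical x = fromℕ< (s≤s (count-mono descent? (toℕ≤pred[n] x)))

  toℕ-canonical : ∀ x → toℕ (canonical x) ≡ descents (toℕ x)
  toℕ-canonical x = toℕ-fromℕ< _

  canonical-surjective : Surj canonical
  canonical-surjective b with count-attains descent? m (toℕ b) (toℕ≤pred[n] b)
  ... | v , v≤m , hit = fin m v ,
        toℕ-injective (trans (toℕ-canonical (fin m v)) (trans (cong descents (toℕ-fin m v≤m)) hit))

  canonical-consecutive : ConsecutiveBlocks canonical
  canonical-consecutive x y z x≤z z≤y same =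
    toℕ-injective (trans (toℕ-canonical z) (trans (≤-antisym z≤x x≤z′) (sym (toℕ-canonical x))))
    where
      same′ : descents (toℕ x) ≡ descents (toℕ y)
      same′ = trans (sym (toℕ-canonical x)) (trans (cong toℕ same) (toℕ-canonical y))
      z≤x : descents (toℕ z) ≤ descents (toℕ x)
      z≤x = subst (descents (toℕ z) ≤_) (sym same′) (count-mono descent? z≤y)
      x≤z′ : descents (toℕ x) ≤ descents (toℕ z)
      x≤z′ = count-mono descent? x≤z

  -- Between two values of one canonical block there is no descent, so
  -- their positions increase step by step.
  canonical-increasing : IncreasingInWord π canonical
  canonical-increasing p q same a<b =
    subst₂ _<_ (cong toℕ (position-of p)) (cong toℕ (position-of q))
      (stepwise-< (λ z → toℕ (position z)) a<b (λ z a≤z z<b →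
        ascent (<-≤-trans z<b (toℕ≤pred[n] (π ⟨$⟩ʳ q)))
               (count-flat descent? a≤z z<b same′)))
    where
      same′ : descents (toℕ (π ⟨$⟩ʳ p)) ≡ descents (toℕ (π ⟨$⟩ʳ q))
      same′ = trans (sym (toℕ-canonical (π ⟨$⟩ʳ p))) (trans (cong toℕ same) (toℕ-canonical (π ⟨$⟩ʳ q)))
      position-of : ∀ r → position (toℕ (π ⟨$⟩ʳ r)) ≡ r
      position-of r = trans (cong (π ⟨$⟩ˡ_) (fin-toℕ m _)) (inverseˡ π)

  canonical-structure : IsConsecStructure π (suc (descents m)) canonical
  canonical-structure = canonical-surjective , canonical-consecutive , canonical-increasing

  existence : Σ ℕ λ i → ∃ λ (f : Fin (suc m) → Fin i) → IsStandardConsec π i f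
  existence = suc (descents m) , canonical , canonical-structure , λ j g → structure-bound g

  -- (4) A standard structure has 1 + descents m blocks, hence no more cuts
  -- than descents; since descents are cuts, every cut is a descent.
  standard-cut⇒descent : ∀ {i} (f : Fin (suc m) → Fin i) → IsStandardConsec π i f →
    ∀ z → z < m → Labelling.Cut f z → Descent z
  standard-cut⇒descent f ((_ , consecutive , increasing) , minimal) =
    count-⊆-tight descent? cut? m (descent⇒cut f increasing)
      (≤-pred (≤-trans cuts<labels (minimal _ canonical canonical-structure)))
    where open Labelling f
          open Consecutive consecutive

  -- Two standard structures have the same cuts, hence the same blocks.
  standard-same-steps : ∀ {i j} (f : Fin (suc m) → Fin i) (g : Fin (suc m) → Fin j) →
    IsStandardConsec π i f → IsStandardConsec π j g →
    ∀ z → z < m → Labelling.label f z ≡ Labelling.label f (suc z) →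
                  Labelling.label g z ≡ Labelling.label g (suc z)
  standard-same-steps f g standard-f standard-g z z<m f-kept
    with Labelling.label g z Fin.≟ Labelling.label g (suc z)
  ... | yes g-kept = g-kept
  ... | no g-cut = ⊥-elim (descent⇒cut f (proj₂ (proj₂ (proj₁ standard-f))) z z<m
                             (standard-cut⇒descent g standard-g z z<m g-cut) f-kept)

  uniqueness : ∀ (i j : ℕ) (f : Fin (suc m) → Fin i) (g : Fin (suc m) → Fin j) →
    IsStandardConsec π i f → IsStandardConsec π j g → SamePartition f g
  uniqueness i j f g standard-f standard-g x y =
    blocks-refine f g (consecutive-of standard-f) (standard-same-steps f g standard-f standard-g) x y ,
    blocks-refine g f (consecutive-of standard-g) (standard-same-steps g f standard-g standard-f) x y
    where
      consecutive-of : ∀ {k} {h : Fin (suc m) → Fin k} → IsStandardConsec π k h → ConsecutiveBlocks h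
      consecutive-of ((_ , consecutive , _) , _) = consecutive

mainTheorem3 : (m : ℕ) (π : Permutation′ (suc m)) → StartsWithOne π →
    (Σ ℕ λ i → ∃ λ (f : Fin (suc m) → Fin i) → IsStandardConsec π i f) ×
    (∀ (i j : ℕ) (f : Fin (suc m) → Fin i) (g : Fin (suc m) → Fin j) →
    IsStandardConsec π i f → IsStandardConsec π j g → SamePartition f g)
mainTheorem3 m π _ = Word.existence m π , Word.uniqueness m π
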